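{- Let $\mathcal{E}$ be a $d$-regular graph, $f$ a linear order of $E(\vec{\mathcal{E}})$ and $G_{\mathcal{E}}$ the graph constructed from them. Let $v\in V(\mathcal{E})$ and $S_v=\{a^e_{18},\dots,a^e_{31}, a^{\tilde e}_1,\dots,a^{\tilde e}_{17}: e\in E^-_{\vec{\mathcal{E}}}(v),\ \tilde e\in E^+_{\vec{\mathcal{E}}}(v)\}\cup\{b^v_1,\dots,b^v_6\}$. Let $G$ be a graph such that $G_{\mathcal{E}}[S_v]$ is a subgraph of $G$. Then for any two sets $T^{\mathrm{in}}_v\subseteq E^-_{\vec{\mathcal{E}}}(v)$ and $T^{\mathrm{out}}_v\subseteq E^+_{\vec{\mathcal{E}}}(v)$ with $|T^{\mathrm{in}}_v|-1=|T^{\mathrm{out}}_v|$ there is a set of $2d$ pairwise vertex-disjoint simple paths $\{P^{\mathrm{in}}_e, P^{\mathrm{out}}_{\tilde e}: e\in E^-_{\vec{\mathcal{E}}}(v),\ \tilde e\in E^+_{\vec{\mathcal{E}}}(v)\}$ in $G$ such that: if $e\in T^{\mathrm{in}}_v$, then $P^{\mathrm{in}}_e$ is a path from $a^e_{20}$ to $a^e_{31}$; if $e\in E^-_{\vec{\mathcal{E}}}(v)\setminus T^{\mathrm{in}}_v$, then $P^{\mathrm{in}}_e$ is a path from $a^e_{18}$ to $a^e_{31}$; if $e\in T^{\mathrm{out}}_v$, then $P^{\mathrm{out}}_e$ is a path from $a^e_1$ to $a^e_{15}$; if $e\in E^+_{\vec{\mathcal{E}}}(v)\setminus T^{\mathrm{out}}_v$,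 then $P^{\mathrm{out}}_e$ is a path from $a^e_1$ to $a^e_{17}$; and the set of vertices lying on at least one of these paths equals $S_v$.
   Context: All graphs are finite and simple; $G[X]$ is the induced subgraph on $X$. For a directed graph, $E^-(v)$ and $E^+(v)$ are the sets of incoming and outgoing edges of $v$. Construction. For a $d$-regular graph $\mathcal{E}$, let $\vec{\mathcal{E}}$ be the directed graph on $V(\mathcal{E})$ containing both $(u,v)$ and $(v,u)$ for each edge $\{u,v\}\in E(\mathcal{E})$. For vertices $v_1,\dots,v_{31}$, $P(v_1,\dots,v_{31})$ is the graph on these vertices with edges $\{v_i,v_{i+1}\}$ ($1\le i\le 30$), $\{v_2,v_5\},\{v_{27},v_{30}\},\{v_6,v_{11}\},\{v_{12},v_{17}\},\{v_{15},v_{20}\},\{v_{21},v_{26}\}$. A link from $P(u_1,\dots,u_{31})$ to $P(v_1,\dots,v_{31})$ via $w_1,\dots,w_6$ consists of the edges $\{u_{23},v_3\},\{u_{18},v_8\},\{u_{29},v_9\},\{u_{24},v_{14}\},\{v_5,w_1\},\{w_1,w_2\},\{w_2,w_3\},\{w_3,u_{23}\},\{u_{24},w_4\},\{w_4,w_5\},\{w_5,w_6\},\{w_6,v_{12}\}$. Let $m=|E(\vec{\mathcal{E}})|$ and $f:E(\vec{\mathcal{E}})\to\{1,\dots,m\}$ a bijection. $G_{\mathcal{E}}$ has pairwise distinct vertices $a^e_1,\dots,a^e_{31}$ for each $e\in E(\vec{\mathcal{E}})$ and $b^v_1,\dots,b^v_6$ for each $v\in V(\mathcal{E})$, and its edge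 set is exactly the union of: the edges of $P(a^e_1,\dots,a^e_{31})$ for each $e$; the edges $\{a^{f^{ -1}(i)}_{31},a^{f^{ -1}(j)}_1\}$ for $i\in\{1,\dots,m\}$, where $j=i+1$ if $i<m$ and $j=1$ if $i=m$; and, for all vertices $u,v,w$ with $(u,v),(v,w)\in E(\vec{\mathcal{E}})$, the edges of a link from $P(a^{(u,v)}_1,\dots,a^{(u,v)}_{31})$ to $P(a^{(v,w)}_1,\dots,a^{(v,w)}_{31})$ via $b^v_1,\dots,b^v_6$. -}

module Defs where

open import Data.Nat using (ℕ; zero; suc; _+_; _≤_)
open import Data.Bool using (Bool; true; false; if_then_else_)
open import Data.Fin using (Fin; toℕ; #_)
import Data.Fin as F
open import Data.Product using (Σ; _×_; _,_; proj₁; proj₂)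
open import Data.Sum using (_⊎_)
open import Data.Empty using (⊥)
open import Data.List using (List; []; _∷_; map; upTo; _++_)
open import Data.List.Membership.Propositional using (_∈_; _∉_)
open import Data.List.Relation.Unary.Unique.Propositional using (Unique)
open import Function.Bundles using (_↔_; Inverse)
open import Relation.Binary.PropositionalEquality using (_≡_; _≢_)

record Graph : Set where
  field
    n     : ℕ
    E     : Fin n → Fin n → Bool
    sym   : ∀ u w → E u w ≡ E w u
    irref : ∀ u → E u u ≡ false

countB : ∀ {k} → (Fin k → Bool) → ℕ
countB {zero}  p = 0
countB {suc k} p = (if p F.zero then 1 else 0) + countB (λ x → p (F.suc x))

degree : (ℰ : Graph) → Fin (Graph.n ℰ) → ℕ
degree ℰ v = countB (Graph.E ℰ v)

Regular : ℕ → Graph → Set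
Regular d ℰ = ∀ v → degree ℰ v ≡ d

record Arc (ℰ : Graph) : Set where
  constructor arc
  field
    src  : Fin (Graph.n ℰ)
    tgt  : Fin (Graph.n ℰ)
    edge : Graph.E ℰ src tgt ≡ true
open Arc public

InArc OutArc : ∀ {ℰ} → Fin (Graph.n ℰ) → Arc ℰ → Set
InArc  v e = tgt e ≡ v
OutArc v e = src e ≡ v

-- a e k  is  a^e_{k+1}   (k : Fin 31, so indices 1..31)
-- b v k  is  b^v_{k+1}   (k : Fin 6,  so indices 1..6)
data Vtx (ℰ : Graph) : Set where
  a : Arc ℰ → Fin 31 → Vtx ℰ
  b : Fin (Graph.n ℰ) → Fin 6 → Vtx ℰ

atA : ∀ {ℰ} → Arc ℰ → ℕ → Vtx ℰ → Set
atA e i (a e' k) = e' ≡ e × suc (toℕ k) ≡ i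
atA e i (b _ _)  = ⊥

atB : ∀ {ℰ} → Fin (Graph.n ℰ) → ℕ → Vtx ℰ → Set
atB v i (a _ _)  = ⊥
atB v i (b v' k) = v' ≡ v × suc (toℕ k) ≡ i

-- edges of P(v_1,…,v_31), as pairs of 1-based indices
pEdges : List (ℕ × ℕ)
pEdges = map (λ i → (suc i , suc (suc i))) (upTo 30)
      ++ ((2 , 5) ∷ (27 , 30) ∷ (6 , 11) ∷ (12 , 17) ∷ (15 , 20) ∷ (21 , 26) ∷ [])

-- endpoints in a link from P(u_1..u_31) to P(v_1..v_31) via w_1..w_6
data End : Set where
  U V W : ℕ → End

linkEdges : List (End × End)
linkEdges =
    (U 23 , V 3) ∷ (U 18 , V 8) ∷ (U 29 , V 9) ∷ (U 24 , V 14)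
  ∷ (V 5 , W 1) ∷ (W 1 , W 2) ∷ (W 2 , W 3) ∷ (W 3 , U 23)
  ∷ (U 24 , W 4) ∷ (W 4 , W 5) ∷ (W 5 , W 6) ∷ (W 6 , V 12) ∷ []

atEnd : ∀ {ℰ} → Arc ℰ → Arc ℰ → Fin (Graph.n ℰ) → End → Vtx ℰ → Set
atEnd e₁ e₂ v (U i) x = atA e₁ i x
atEnd e₁ e₂ v (V i) x = atA e₂ i x
atEnd e₁ e₂ v (W i) x = atB v i x

-- cyclic successor in the order {1..m} (here 0-based Fin m)
CycNext : (m : ℕ) → Fin m → Fin m → Set
CycNext m i j = (suc (toℕ i) ≡ toℕ j) ⊎ (suc (toℕ i) ≡ m × toℕ j ≡ 0)

module _ {ℰ : Graph} {m : ℕ} (f : Arc ℰ ↔ Fin m) where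
  open Inverse f using (to)

  PathEdge : Vtx ℰ → Vtx ℰ → Set
  PathEdge x y = Σ (Arc ℰ) λ e → Σ (ℕ × ℕ) λ ij →
    ij ∈ pEdges × atA e (proj₁ ij) x × atA e (proj₂ ij) y

  CycleEdge : Vtx ℰ → Vtx ℰ → Set
  CycleEdge x y = Σ (Arc ℰ) λ e → Σ (Arc ℰ) λ e' →
    CycNext m (to e) (to e') × atA e 31 x × atA e' 1 y

  LinkEdge : Vtx ℰ → Vtx ℰ → Set
  LinkEdge x y = Σ (Arc ℰ) λ e₁ → Σ (Arc ℰ) λ e₂ → tgt e₁ ≡ src e₂ ×
    Σ (End × End) λ pq → pq ∈ linkEdges ×
      atEnd e₁ e₂ (tgt e₁) (proj₁ pq) x × atEnd e₁ e₂ (tgt e₁) (proj₂ pq) y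

  BaseEdge : Vtx ℰ → Vtx ℰ → Set
  BaseEdge x y = PathEdge x y ⊎ CycleEdge x y ⊎ LinkEdge x y

  GEdge : Vtx ℰ → Vtx ℰ → Set
  GEdge x y = BaseEdge x y ⊎ BaseEdge y x

InS : ∀ {ℰ} → Fin (Graph.n ℰ) → Vtx ℰ → Set
InS v (a e k)  = (InArc v e × 18 ≤ suc (toℕ k)) ⊎ (OutArc v e × suc (toℕ k) ≤ 17)
InS v (b v' k) = v' ≡ v

record SimpleGraph : Set₁ where
  field
    N     : ℕ
    Adj   : Fin N → Fin N → Set
    sym   : ∀ x y → Adj x y → Adj y x
    irref : ∀ x → Adj x x → ⊥

data Walk (G : SimpleGraph) : Fin (SimpleGraph.N G) → Fin (SimpleGraph.N G)
          → List (Fin (SimpleGraph.N G)) → Set where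
  stop : ∀ s → Walk G s s (s ∷ [])
  step : ∀ {s u t p} → SimpleGraph.Adj G s u → Walk G u t p → Walk G s t (s ∷ p)

IsPath : (G : SimpleGraph) → Fin (SimpleGraph.N G) → Fin (SimpleGraph.N G)
       → List (Fin (SimpleGraph.N G)) → Set
IsPath G s t p = Walk G s t p × Unique p

-- G_ℰ[S_v] is a subgraph of G, via an identification ι of S_v with vertices of G
-- (ι is injective on S_v and maps edges of G_ℰ[S_v] to edges of G;
--  its values outside S_v are irrelevant)
record Contains {ℰ : Graph} {m : ℕ} (f : Arc ℰ ↔ Fin m) (v : Fin (Graph.n ℰ))
                (G : SimpleGraph) : Set where
  field
    ι       : Vtx ℰ → Fin (SimpleGraph.N G)
    inj     : ∀ x y → InS v x → InS v y → ι x ≡ ι y → x ≡ y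
    edges   : ∀ x y → InS v x → InS v y → GEdge f x y → SimpleGraph.Adj G (ι x) (ι y)

-- labels of the 2d paths: P^in_e (e ∈ E⁻(v)) and P^out_e (e ∈ E⁺(v))
data Dir : Set where
  inD outD : Dir

Rel : ∀ {ℰ} → Fin (Graph.n ℰ) → Dir → Arc ℰ → Set
Rel v inD  e = InArc v e
Rel v outD e = OutArc v e

Good : ∀ {ℰ m} (f : Arc ℰ ↔ Fin m) (v : Fin (Graph.n ℰ)) (G : SimpleGraph)
       (C : Contains f v G) (Tin Tout : List (Arc ℰ))
       (P : Dir → Arc ℰ → List (Fin (SimpleGraph.N G))) → Set
Good {ℰ} f v G C Tin Tout P =
    (∀ e → InArc v e → e ∈ Tin → IsPath G (ι (a e (# 19))) (ι (a e (# 30))) (P inD e))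
  × (∀ e → InArc v e → e ∉ Tin → IsPath G (ι (a e (# 17))) (ι (a e (# 30))) (P inD e))
  × (∀ e → OutArc v e → e ∈ Tout → IsPath G (ι (a e (# 0))) (ι (a e (# 14))) (P outD e))
  × (∀ e → OutArc v e → e ∉ Tout → IsPath G (ι (a e (# 0))) (ι (a e (# 16))) (P outD e))
  × (∀ s e s' e' → Rel v s e → Rel v s' e' → (s , e) ≢ (s' , e')
       → ∀ w → w ∈ P s e → w ∈ P s' e' → ⊥)
  × (∀ w → (Σ Dir λ s → Σ (Arc ℰ) λ e → Rel v s e × w ∈ P s e)
         → Σ (Vtx ℰ) λ x → InS v x × ι x ≡ w)
  × (∀ w → (Σ (Vtx ℰ) λ x → InS v x × ι x ≡ w)
         → Σ Dir λ s → Σ (Arc ℰ) λ e → Rel v s e × w ∈ P s e)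
  where open Contains C

module Submission where

open import Defs
open import Data.Nat using (ℕ; suc; _≤_; _<_; s≤s; z≤n)
open import Data.Fin using (Fin)
open import Data.Product using (Σ)
open import Data.List using (List; length)
open import Data.List.Relation.Unary.All using (All)
open import Data.List.Relation.Unary.Unique.Propositional using (Unique)
open import Function.Bundles using (_↔_)
open import Relation.Binary.PropositionalEquality using (_≡_)

import Data.Nat as ℕ
import Data.Nat.Properties as ℕP
open import Data.Nat.Properties using (<⇒≱; ≤-reflexive)
open import Data.Fin using (toℕ; #_)
import Data.Fin.Properties as FP
import Data.Bool.Properties as BoolP
open import Data.Product using (_×_; _,_; proj₁; proj₂; ∃; uncurry)
import Data.Product as Prod
open import Data.Product.Properties using (≡-dec)
open import Data.Sum using (_⊎_; inj₁; inj₂)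
open import Data.Empty using (⊥; ⊥-elim)
open import Data.Maybe using (Maybe; just; nothing)
open import Data.List using ([]; _∷_; _++_; map; zip; find; allFin; take; drop)
open import Data.List.Properties using (length-map)
open import Data.List.Relation.Unary.All using ([]; _∷_; all?)
import Data.List.Relation.Unary.All as All
open import Data.List.Relation.Unary.All.Properties using (All¬⇒¬Any; ¬Any⇒All¬; ¬All⇒Any¬)
import Data.List.Relation.Unary.All.Properties as AllP
open import Data.List.Relation.Unary.Any using (here; there)
open import Data.List.Relation.Unary.AllPairs using ([]; _∷_)
open import Data.List.Relation.Unary.Linked using (Linked; []; [-]; _∷_; linked?)
import Data.List.Relation.Unary.Linked as Linked
import Data.List.Relation.Unary.Linked.Properties as LinkedP
import Data.List.Relation.Unary.Unique.Propositional.Properties as UniqueP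
open import Data.List.Relation.Unary.Unique.DecPropositional using (unique?)
open import Data.List.Membership.Propositional using (_∈_; _∉_) renaming (find to member-satisfying)
open import Data.List.Membership.Propositional.Properties using (∈-map⁺; ∈-map⁻; ∈-++⁻)
import Data.List.Membership.DecPropositional as DecMembership
open import Data.List.Relation.Binary.Subset.Propositional using (_⊆_)
open import Relation.Nullary using (Dec; yes; no; ¬?)
open import Relation.Nullary.Decidable using (map′; from-yes; _×-dec_; _⊎-dec_; _→-dec_)
open import Relation.Unary using (Decidable)
open import Relation.Binary.Definitions using (DecidableEquality)
open import Relation.Binary.PropositionalEquality using (_≢_; refl; sym; trans; cong; subst)
open import Axiom.UniquenessOfIdentityProofs using (module Decidable⇒UIP)
open import Function.Base using (case_of_)

-- Reversing the |T_out| + 1 arcs of T_in gives distinct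
-- out-arcs at v, so by pigeonhole there is an out-arc ẽ ∉ T_out (`spare-out-arc`).
-- Pair T_in positionally with ẽ ∷ T_out.  A pair (x , y) of an in-arc and an out-arc at
-- v spans a gadget in G_ℰ[S_v]: the vertices a^x_18..31, a^y_1..17 and b^v_1..6 with the
-- P-edges of x and y and the link from x to y.  Gadget vertices are named by labels
-- (`Lab`) and the required paths are explicit label sequences: P^in_x runs from a^x_20
-- to a^x_31 through a^y_6..11; P^out_y runs from a^y_1 to a^y_15 through a^x_21..26
-- (y ∈ T_out) or, for y = ẽ, to a^y_17 also through b^v.  Unpaired arcs keep their
-- straight segment of P.  The finitely many facts about these sequences (adjacency,
-- lying in S_v, no repetition, disjointness, coverage) are decided by evaluation and
-- transported to G along the embedding ι of G_ℰ[S_v] (`route-path`).  Disjointness of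
-- the family follows from an `owner` function naming the path through each vertex.

module _ {A : Set} where

  remove : ∀ {x : A} {ys} → x ∈ ys → List A
  remove {ys = _ ∷ ys} (here _)  = ys
  remove {ys = y ∷ _}  (there p) = y ∷ remove p

  length-remove : ∀ {x : A} {ys} (p : x ∈ ys) → length ys ≡ suc (length (remove p))
  length-remove (here _)  = refl
  length-remove (there p) = cong suc (length-remove p)

  ∈-remove : ∀ {x z : A} {ys} (p : x ∈ ys) → z ∈ ys → z ≢ x → z ∈ remove p
  ∈-remove (here refl) (here refl) z≢x = ⊥-elim (z≢x refl)
  ∈-remove (here _)    (there q)   _   = q
  ∈-remove (there _)   (here q)    _   = here q
  ∈-remove (there p)   (there q)   z≢x = there (∈-remove p q z≢x)

  unique-⊆⇒length-≤ : ∀ {xs ys : List A} → Unique xs → xs ⊆ ys → length xs ≤ length ys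
  unique-⊆⇒length-≤ {[]}     _           _     = z≤n
  unique-⊆⇒length-≤ {x ∷ xs} {ys} (x∉xs ∷ u) xs⊆ys =
    subst (suc (length xs) ≤_) (sym (length-remove x∈ys))
      (s≤s (unique-⊆⇒length-≤ u λ z∈xs →
        ∈-remove x∈ys (xs⊆ys (there z∈xs)) λ { refl → All¬⇒¬Any x∉xs z∈xs }))
    where x∈ys = xs⊆ys (here refl)

  pigeonhole : DecidableEquality A → ∀ {xs ys : List A} → Unique xs → length ys < length xs
             → ∃ λ x → x ∈ xs × x ∉ ys
  pigeonhole _≟_ {xs} {ys} u ys<xs =
    case all? (_∈? ys) xs of λ where
      (yes xs⊆ys) → ⊥-elim (<⇒≱ ys<xs (unique-⊆⇒length-≤ u (All.lookup xs⊆ys)))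
      (no  xs⊈ys) → member-satisfying (¬All⇒Any¬ (_∈? ys) xs xs⊈ys)
    where open DecMembership _≟_ using (_∈?_)

  unique-map-on : ∀ {B : Set} {P : A → Set} (g : A → B)
                → (∀ {x y} → P x → P y → g x ≡ g y → x ≡ y)
                → ∀ {xs} → All P xs → Unique xs → Unique (map g xs)
  unique-map-on g inj []         []         = []
  unique-map-on g inj (px ∷ pxs) (x∉ ∷ u) =
    AllP.map⁺ (All.zipWith (λ (py , x≢y) gx≡gy → x≢y (inj px py gx≡gy)) (pxs , x∉))
      ∷ unique-map-on g inj pxs u

module _ {A : Set} where

  find-sound : ∀ {P : A → Set} (P? : Decidable P) xs {t} → find P? xs ≡ just t → t ∈ xs × P t
  find-sound P? (x ∷ xs) eq with P? x
  find-sound P? (x ∷ xs) refl | yes px = here refl , px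
  ... | no _ = Prod.map₁ there (find-sound P? xs eq)

  find-key : ∀ {K : Set} (_≟_ : DecidableEquality K) (key : A → K) {xs t}
           → Unique (map key xs) → t ∈ xs → find (λ s → key s ≟ key t) xs ≡ just t
  find-key _≟_ key {x ∷ xs} _ (here refl) with key x ≟ key x
  ... | yes _  = refl
  ... | no  ≢ = ⊥-elim (≢ refl)
  find-key _≟_ key {x ∷ xs} {t} (key∉ ∷ u) (there t∈) with key x ≟ key t
  ... | yes eq = ⊥-elim (All¬⇒¬Any key∉ (subst (_∈ map key xs) (sym eq) (∈-map⁺ key t∈)))
  ... | no  _  = find-key _≟_ key u t∈

  find-in-keys : ∀ {K : Set} (_≟_ : DecidableEquality K) (key : A → K) {xs k}
               → Unique (map key xs) → k ∈ map key xs → find (λ s → key s ≟ k) xs ≢ nothing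
  find-in-keys _≟_ key u k∈ with ∈-map⁻ key k∈
  ... | t , t∈ , refl = λ eq → nothing≢just (trans (sym eq) (find-key _≟_ key u t∈))
    where
    nothing≢just : ∀ {B : Set} {b : B} → nothing ≢ just b
    nothing≢just ()

  module _ {B : Set} where

    map-proj₁-zip : ∀ (xs : List A) (ys : List B) → length xs ≡ length ys → map proj₁ (zip xs ys) ≡ xs
    map-proj₁-zip []       []       _  = refl
    map-proj₁-zip (x ∷ xs) (y ∷ ys) eq = cong (x ∷_) (map-proj₁-zip xs ys (ℕP.suc-injective eq))

    map-proj₂-zip : ∀ (xs : List A) (ys : List B) → length xs ≡ length ys → map proj₂ (zip xs ys) ≡ ys
    map-proj₂-zip []       []       _  = refl
    map-proj₂-zip (x ∷ xs) (y ∷ ys) eq = cong (y ∷_) (map-proj₂-zip xs ys (ℕP.suc-injective eq))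

lastOf : ∀ {A : Set} → A → List A → A
lastOf x []       = x
lastOf _ (y ∷ ys) = lastOf y ys

module _ {ℰ : Graph} where

  -- An arc is determined by its endpoints (the adjacency proof is a Bool equation, hence unique).
  arc-≡ : ∀ {s t s' t' p p'} → s ≡ s' → t ≡ t' → _≡_ {A = Arc ℰ} (arc s t p) (arc s' t' p')
  arc-≡ {p = p} {p'} refl refl = cong (arc _ _) (Decidable⇒UIP.≡-irrelevant BoolP._≟_ p p')

  _≟A_ : DecidableEquality (Arc ℰ)
  arc s t p ≟A arc s' t' p' =
    map′ (uncurry arc-≡) (λ eq → cong src eq , cong tgt eq) ((s FP.≟ s') ×-dec (t FP.≟ t'))

  opposite : Arc ℰ → Arc ℰ
  opposite e = arc (tgt e) (src e) (trans (Graph.sym ℰ (tgt e) (src e)) (edge e))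

  opposite-injective : ∀ {e e'} → opposite e ≡ opposite e' → e ≡ e'
  opposite-injective eq = arc-≡ (cong tgt eq) (cong src eq)

  -- ℰ has no loops, so no arc is both an in-arc and an out-arc at v.
  in-and-out : ∀ {v} {e : Arc ℰ} → InArc v e → OutArc v e → ⊥
  in-and-out {e = arc s _ p} refl refl with trans (sym p) (Graph.irref ℰ s)
  ... | ()

  -- Reversing T_in yields |T_out| + 1 distinct out-arcs at v, so one of them avoids T_out.
  spare-out-arc : ∀ {v} {Tin Tout : List (Arc ℰ)} → All (InArc v) Tin → Unique Tin
                → length Tin ≡ suc (length Tout) → ∃ λ ẽ → OutArc v ẽ × ẽ ∉ Tout
  spare-out-arc {Tin = Tin} Tin-in uTin len
    with pigeonhole _≟A_ (UniqueP.map⁺ opposite-injective uTin)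
           (≤-reflexive (sym (trans (length-map opposite Tin) len)))
  ... | ẽ , ẽ∈ , ẽ∉ with ∈-map⁻ opposite ẽ∈
  ...   | e , e∈ , refl = opposite e , All.lookup Tin-in e∈ , ẽ∉

module Embedding {ℰ : Graph} {m : ℕ} (f : Arc ℰ ↔ Fin m) (v : Fin (Graph.n ℰ))
                 (G : SimpleGraph) (C : Contains f v G) where
  open Contains C

  chain⇒walk : ∀ {u us} → All (InS v) (u ∷ us) → Linked (GEdge f) (u ∷ us)
             → Walk G (ι u) (ι (lastOf u us)) (map ι (u ∷ us))
  chain⇒walk (_ ∷ [])                  [-]        = stop _
  chain⇒walk (inS ∷ inS's@(inS' ∷ _)) (uu' ∷ ch) = step (edges _ _ inS inS' uu') (chain⇒walk inS's ch)

  chain⇒path : ∀ {u us} → All (InS v) (u ∷ us) → Linked (GEdge f) (u ∷ us) → Unique (u ∷ us)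
             → IsPath G (ι u) (ι (lastOf u us)) (map ι (u ∷ us))
  chain⇒path inS ch u = chain⇒walk inS ch , unique-map-on ι (inj _ _) inS u

-- Gadget labels: X k, Y k, Bv k stand for a^x_{k+1}, a^y_{k+1}, b^v_{k+1} of a pair (x , y)
-- consisting of an in-arc x and an out-arc y at v (indices are 0-based like in Vtx).

data Lab : Set where
  X Y : Fin 31 → Lab
  Bv  : Fin 6 → Lab

_≟L_ : DecidableEquality Lab
X k  ≟L X k'  = map′ (cong X)  (λ { refl → refl }) (k FP.≟ k')
Y k  ≟L Y k'  = map′ (cong Y)  (λ { refl → refl }) (k FP.≟ k')
Bv k ≟L Bv k' = map′ (cong Bv) (λ { refl → refl }) (k FP.≟ k')
X _  ≟L Y _   = no λ ()
X _  ≟L Bv _  = no λ ()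
Y _  ≟L X _   = no λ ()
Y _  ≟L Bv _  = no λ ()
Bv _ ≟L X _   = no λ ()
Bv _ ≟L Y _   = no λ ()

_≟End_ : DecidableEquality End
U i ≟End U j = map′ (cong U) (λ { refl → refl }) (i ℕ.≟ j)
V i ≟End V j = map′ (cong V) (λ { refl → refl }) (i ℕ.≟ j)
W i ≟End W j = map′ (cong W) (λ { refl → refl }) (i ℕ.≟ j)
U _ ≟End V _ = no λ ()
U _ ≟End W _ = no λ ()
V _ ≟End U _ = no λ ()
V _ ≟End W _ = no λ ()
W _ ≟End U _ = no λ ()
W _ ≟End V _ = no λ ()

open DecMembership _≟L_ using () renaming (_∈?_ to _∈L?_)
open DecMembership (≡-dec _≟End_ _≟End_) using () renaming (_∈?_ to _∈End?_)

toEnd : Lab → End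
toEnd (X k)  = U (suc (toℕ k))
toEnd (Y k)  = V (suc (toℕ k))
toEnd (Bv k) = W (suc (toℕ k))

gadgetEnds : List (End × End)
gadgetEnds = map (Prod.map U U) pEdges ++ map (Prod.map V V) pEdges ++ linkEdges

LabArrow LabEdge : Lab → Lab → Set
LabArrow l l' = (toEnd l , toEnd l') ∈ gadgetEnds
LabEdge  l l' = LabArrow l l' ⊎ LabArrow l' l

data LabInS : Lab → Set where
  X∈S  : ∀ {k} → 18 ≤ suc (toℕ k) → LabInS (X k)
  Y∈S  : ∀ {k} → suc (toℕ k) ≤ 17 → LabInS (Y k)
  Bv∈S : ∀ {k} → LabInS (Bv k)

labInS? : Decidable LabInS
labInS? (X k)  = map′ X∈S (λ { (X∈S le) → le }) (18 ℕ.≤? suc (toℕ k))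
labInS? (Y k)  = map′ Y∈S (λ { (Y∈S le) → le }) (suc (toℕ k) ℕ.≤? 17)
labInS? (Bv k) = yes Bv∈S

GadgetPath : List Lab → Set
GadgetPath ls = Linked LabEdge ls × All LabInS ls × Unique ls

gadgetPath? : Decidable GadgetPath
gadgetPath? ls = linked? labEdge? ls ×-dec all? labInS? ls ×-dec unique? _≟L_ ls
  where
  labEdge? : ∀ l l' → Dec (LabEdge l l')
  labEdge? l l' = ((toEnd l , toEnd l') ∈End? gadgetEnds) ⊎-dec ((toEnd l' , toEnd l) ∈End? gadgetEnds)

straightIn straightOut : List Lab
straightIn  = map X (drop 17 (allFin 31))
straightOut = map Y (take 17 (allFin 31))

-- P^in_x for x ∈ T_in: a^x_20 … a^x_31, detouring through a^y_6 … a^y_11.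
gadgetIn : List Lab
gadgetIn = X (# 19) ∷ X (# 18) ∷ X (# 17) ∷ Y (# 7) ∷ Y (# 6) ∷ Y (# 5) ∷ Y (# 10) ∷ Y (# 9)
         ∷ Y (# 8) ∷ X (# 28) ∷ X (# 27) ∷ X (# 26) ∷ X (# 29) ∷ X (# 30) ∷ []

-- P^out_y for y ∈ T_out: a^y_1 … a^y_15, detouring through a^x_21 … a^x_26.
gadgetOut15 : List Lab
gadgetOut15 = Y (# 0) ∷ Y (# 1) ∷ Y (# 4) ∷ Y (# 3) ∷ Y (# 2) ∷ X (# 22) ∷ X (# 21) ∷ X (# 20)
            ∷ X (# 25) ∷ X (# 24) ∷ X (# 23) ∷ Y (# 13) ∷ Y (# 12) ∷ Y (# 11) ∷ Y (# 16)
            ∷ Y (# 15) ∷ Y (# 14) ∷ []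

-- P^out_ẽ for the spare arc ẽ: a^ẽ_1 … a^ẽ_17, detouring through b^v and a^x_21 … a^x_26.
gadgetOut17 : List Lab
gadgetOut17 = Y (# 0) ∷ Y (# 1) ∷ Y (# 2) ∷ Y (# 3) ∷ Y (# 4) ∷ Bv (# 0) ∷ Bv (# 1) ∷ Bv (# 2)
            ∷ X (# 22) ∷ X (# 21) ∷ X (# 20) ∷ X (# 25) ∷ X (# 24) ∷ X (# 23) ∷ Bv (# 3)
            ∷ Bv (# 4) ∷ Bv (# 5) ∷ Y (# 11) ∷ Y (# 12) ∷ Y (# 13) ∷ Y (# 14) ∷ Y (# 15)
            ∷ Y (# 16) ∷ []

outLabels : ∀ {A : Set} → Dec A → List Lab
outLabels (yes _) = gadgetOut15
outLabels (no _)  = gadgetOut17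

straightIn-path  : GadgetPath straightIn
straightIn-path  = from-yes (gadgetPath? straightIn)
straightOut-path : GadgetPath straightOut
straightOut-path = from-yes (gadgetPath? straightOut)
gadgetIn-path    : GadgetPath gadgetIn
gadgetIn-path    = from-yes (gadgetPath? gadgetIn)
gadgetOut15-path : GadgetPath gadgetOut15
gadgetOut15-path = from-yes (gadgetPath? gadgetOut15)
gadgetOut17-path : GadgetPath gadgetOut17
gadgetOut17-path = from-yes (gadgetPath? gadgetOut17)

gadgetOut15-avoids-in : All (_∉ gadgetIn) gadgetOut15
gadgetOut15-avoids-in = from-yes (all? (λ l → ¬? (l ∈L? gadgetIn)) gadgetOut15)
gadgetOut17-avoids-in : All (_∉ gadgetIn) gadgetOut17
gadgetOut17-avoids-in = from-yes (all? (λ l → ¬? (l ∈L? gadgetIn)) gadgetOut17)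

hub-only-on-17 : ∀ k → Bv k ∉ gadgetIn × Bv k ∉ gadgetOut15 × Bv k ∈ gadgetOut17
hub-only-on-17 = from-yes (FP.all? λ k →
  ¬? (Bv k ∈L? gadgetIn) ×-dec ¬? (Bv k ∈L? gadgetOut15) ×-dec (Bv k ∈L? gadgetOut17))

pair-covers-X : ∀ k → LabInS (X k) → X k ∈ gadgetIn ⊎ (X k ∈ gadgetOut15 × X k ∈ gadgetOut17)
pair-covers-X = from-yes (FP.all? λ k → labInS? (X k) →-dec
  ((X k ∈L? gadgetIn) ⊎-dec ((X k ∈L? gadgetOut15) ×-dec (X k ∈L? gadgetOut17))))

pair-covers-Y : ∀ k → LabInS (Y k) → Y k ∈ gadgetIn ⊎ (Y k ∈ gadgetOut15 × Y k ∈ gadgetOut17)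
pair-covers-Y = from-yes (FP.all? λ k → labInS? (Y k) →-dec
  ((Y k ∈L? gadgetIn) ⊎-dec ((Y k ∈L? gadgetOut15) ×-dec (Y k ∈L? gadgetOut17))))

straightIn-covers : ∀ k → LabInS (X k) → X k ∈ straightIn
straightIn-covers = from-yes (FP.all? λ k → labInS? (X k) →-dec (X k ∈L? straightIn))

straightOut-covers : ∀ k → LabInS (Y k) → Y k ∈ straightOut
straightOut-covers = from-yes (FP.all? λ k → labInS? (Y k) →-dec (Y k ∈L? straightOut))

module _ {ℰ : Graph} where

  interp : Arc ℰ → Arc ℰ → Lab → Vtx ℰ
  interp x y (X k)  = a x k
  interp x y (Y k)  = a y k
  interp x y (Bv k) = b (tgt x) k

  interp-atEnd : ∀ x y {l p} → toEnd l ≡ p → atEnd x y (tgt x) p (interp x y l)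
  interp-atEnd x y {X _}  refl = refl , refl
  interp-atEnd x y {Y _}  refl = refl , refl
  interp-atEnd x y {Bv _} refl = refl , refl

  interp-inS : ∀ {v x y} → InArc v x → OutArc v y → ∀ {l} → LabInS l → InS v (interp x y l)
  interp-inS x-in y-out (X∈S le) = inj₁ (x-in , le)
  interp-inS x-in y-out (Y∈S le) = inj₂ (y-out , le)
  interp-inS x-in y-out Bv∈S     = x-in

  interp-injective : ∀ {x y} → x ≢ y → ∀ {l l'} → interp x y l ≡ interp x y l' → l ≡ l'
  interp-injective x≢y {X _}  {X _}  refl = refl
  interp-injective x≢y {Y _}  {Y _}  refl = refl
  interp-injective x≢y {Bv _} {Bv _} refl = refl
  interp-injective x≢y {X _}  {Y _}  refl = ⊥-elim (x≢y refl)
  interp-injective x≢y {Y _}  {X _}  refl = ⊥-elim (x≢y refl)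
  interp-injective x≢y {X _}  {Bv _} ()
  interp-injective x≢y {Y _}  {Bv _} ()
  interp-injective x≢y {Bv _} {X _}  ()
  interp-injective x≢y {Bv _} {Y _}  ()

  module _ {m : ℕ} (f : Arc ℰ ↔ Fin m) where

    arrow-sound : ∀ {x y} → tgt x ≡ src y → ∀ {l l'} → LabArrow l l'
                → BaseEdge f (interp x y l) (interp x y l')
    arrow-sound {x} {y} link {l} {l'} e with ∈-++⁻ (map (Prod.map U U) pEdges) e
    ... | inj₁ e∈Px with ∈-map⁻ (Prod.map U U) e∈Px
    ...   | ij , ij∈ , eq =
      inj₁ (x , ij , ij∈ , interp-atEnd x y (cong proj₁ eq) , interp-atEnd x y (cong proj₂ eq))
    arrow-sound {x} {y} link {l} {l'} e | inj₂ e' with ∈-++⁻ (map (Prod.map V V) pEdges) e'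
    ... | inj₁ e∈Py with ∈-map⁻ (Prod.map V V) e∈Py
    ...   | ij , ij∈ , eq =
      inj₁ (y , ij , ij∈ , interp-atEnd x y (cong proj₁ eq) , interp-atEnd x y (cong proj₂ eq))
    arrow-sound {x} {y} link {l} {l'} e | inj₂ e' | inj₂ e∈link =
      inj₂ (inj₂ (x , y , link , _ , e∈link , interp-atEnd x y {l} refl , interp-atEnd x y {l'} refl))

    edge-sound : ∀ {x y} → tgt x ≡ src y → ∀ {l l'} → LabEdge l l'
               → GEdge f (interp x y l) (interp x y l')
    edge-sound link (inj₁ e) = inj₁ (arrow-sound link e)
    edge-sound link (inj₂ e) = inj₂ (arrow-sound link e)

record Route (ℰ : Graph) : Set where
  constructor route
  field
    inArc outArc : Arc ℰ
    labels       : List Lab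

vertices : ∀ {ℰ} → Route ℰ → List (Vtx ℰ)
vertices (route x y ls) = map (interp x y) ls

-- Which of the two paths of a pair (x , y) passes through the vertex labelled l.
sideOf : ∀ {ℰ} → Lab → Arc ℰ → Arc ℰ → Dir × Arc ℰ
sideOf l x y with l ∈L? gadgetIn
... | yes _ = inD , x
... | no  _ = outD , y

sideOf-in : ∀ {ℰ} {l} {x y : Arc ℰ} → l ∈ gadgetIn → sideOf l x y ≡ (inD , x)
sideOf-in {l = l} l∈ with l ∈L? gadgetIn
... | yes _ = refl
... | no l∉ = ⊥-elim (l∉ l∈)

sideOf-out : ∀ {ℰ} {l} {x y : Arc ℰ} → l ∉ gadgetIn → sideOf l x y ≡ (outD , y)
sideOf-out {l = l} l∉ with l ∈L? gadgetIn
... | yes l∈ = ⊥-elim (l∉ l∈)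
... | no _   = refl

outLabels-path : ∀ {A : Set} (d : Dec A) → GadgetPath (outLabels d)
outLabels-path (yes _) = gadgetOut15-path
outLabels-path (no _)  = gadgetOut17-path

module Construction {ℰ : Graph} {m : ℕ} (f : Arc ℰ ↔ Fin m) (v : Fin (Graph.n ℰ))
  (G : SimpleGraph) (C : Contains f v G) (Tin Tout : List (Arc ℰ)) (ẽ : Arc ℰ)
  (Tin-in : All (InArc v) Tin) (uTin : Unique Tin)
  (ẽ-out : OutArc v ẽ) (Tout-out : All (OutArc v) Tout) (ẽ∉Tout : ẽ ∉ Tout) (uTout : Unique Tout)
  (len : length Tin ≡ suc (length Tout)) where

  open Contains C
  open Embedding f v G C
  open DecMembership (_≟A_ {ℰ}) using () renaming (_∈?_ to _∈A?_)

  outs : List (Arc ℰ)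
  outs = ẽ ∷ Tout

  uouts : Unique outs
  uouts = ¬Any⇒All¬ Tout ẽ∉Tout ∷ uTout

  pairs : List (Arc ℰ × Arc ℰ)
  pairs = zip Tin outs

  firsts : map proj₁ pairs ≡ Tin
  firsts = map-proj₁-zip Tin outs len

  seconds : map proj₂ pairs ≡ outs
  seconds = map-proj₂-zip Tin outs len

  first∈ : ∀ {x y} → (x , y) ∈ pairs → x ∈ Tin
  first∈ p = subst (_ ∈_) firsts (∈-map⁺ proj₁ p)

  second∈ : ∀ {x y} → (x , y) ∈ pairs → y ∈ outs
  second∈ p = subst (_ ∈_) seconds (∈-map⁺ proj₂ p)

  pair-arcs : ∀ {x y} → (x , y) ∈ pairs → InArc v x × OutArc v y
  pair-arcs p = All.lookup Tin-in (first∈ p) , All.lookup (ẽ-out ∷ Tout-out) (second∈ p)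

  spare : ∀ {x y} → (x , y) ∈ pairs → y ∉ Tout → y ≡ ẽ
  spare p y∉ with second∈ p
  ... | here y≡ẽ = y≡ẽ
  ... | there y∈ = ⊥-elim (y∉ y∈)

  partnerIn partnerOut : Arc ℰ → Maybe (Arc ℰ × Arc ℰ)
  partnerIn  e = find (λ p → proj₁ p ≟A e) pairs
  partnerOut e = find (λ p → proj₂ p ≟A e) pairs

  pairedIn : ∀ {x y} → (x , y) ∈ pairs → partnerIn x ≡ just (x , y)
  pairedIn = find-key _≟A_ proj₁ (subst Unique (sym firsts) uTin)

  pairedOut : ∀ {x y} → (x , y) ∈ pairs → partnerOut y ≡ just (x , y)
  pairedOut = find-key _≟A_ proj₂ (subst Unique (sym seconds) uouts)

  unpairedIn : ∀ {e} → partnerIn e ≡ nothing → e ∉ Tin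
  unpairedIn eq e∈ =
    find-in-keys _≟A_ proj₁ (subst Unique (sym firsts) uTin) (subst (_ ∈_) (sym firsts) e∈) eq

  unpairedOut : ∀ {e} → partnerOut e ≡ nothing → e ∉ outs
  unpairedOut eq e∈ =
    find-in-keys _≟A_ proj₂ (subst Unique (sym seconds) uouts) (subst (_ ∈_) (sym seconds) e∈) eq

  data InView (e : Arc ℰ) : Set where
    unpaired : partnerIn e ≡ nothing → InView e
    paired   : ∀ {y} → (e , y) ∈ pairs → InView e

  inView : ∀ e → InView e
  inView e with partnerIn e in eq
  ... | nothing = unpaired eq
  ... | just (x , y) with find-sound _ pairs eq
  ...   | p , refl = paired p

  data OutView (e : Arc ℰ) : Set where
    unpaired : partnerOut e ≡ nothing → OutView e
    paired   : ∀ {x} → (x , e) ∈ pairs → OutView e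

  outView : ∀ e → OutView e
  outView e with partnerOut e in eq
  ... | nothing = unpaired eq
  ... | just (x , y) with find-sound _ pairs eq
  ...   | p , refl = paired p

  inRouteFor : Arc ℰ → Maybe (Arc ℰ × Arc ℰ) → Route ℰ
  inRouteFor e (just (x , y)) = route x y gadgetIn
  inRouteFor e nothing        = route e ẽ straightIn

  outRouteFor : Arc ℰ → Maybe (Arc ℰ × Arc ℰ) → Route ℰ
  outRouteFor e (just (x , y)) = route x y (outLabels (y ∈A? Tout))
  outRouteFor e nothing        = route (opposite ẽ) e straightOut

  routeOf : Dir → Arc ℰ → Route ℰ
  routeOf inD  e = inRouteFor e (partnerIn e)
  routeOf outD e = outRouteFor e (partnerOut e)

  P : Dir → Arc ℰ → List (Fin (SimpleGraph.N G))
  P s e = map ι (vertices (routeOf s e))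

  ValidRoute : Route ℰ → Set
  ValidRoute (route x y ls) = InArc v x × OutArc v y × GadgetPath ls

  valid-in-S : ∀ r → ValidRoute r → All (InS v) (vertices r)
  valid-in-S (route x y ls) (x-in , y-out , _ , inS , _) = AllP.map⁺ (All.map (interp-inS x-in y-out) inS)

  route-path : ∀ {x y} → InArc v x → OutArc v y → ∀ {l ls} → GadgetPath (l ∷ ls)
             → IsPath G (ι (interp x y l)) (ι (lastOf (interp x y l) (map (interp x y) ls)))
                      (map ι (map (interp x y) (l ∷ ls)))
  route-path {x} {y} x-in y-out {l} {ls} gp@(chain , _ , unique) =
    chain⇒path (valid-in-S (route x y (l ∷ ls)) (x-in , y-out , gp))
               (LinkedP.map⁺ (Linked.map (edge-sound f (trans x-in (sym y-out))) chain))
               (UniqueP.map⁺ (interp-injective λ { refl → in-and-out {e = x} x-in y-out }) unique)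

  route-valid : ∀ {s e} → Rel v s e → ValidRoute (routeOf s e)
  route-valid {inD} {e} e-in with inView e
  ... | unpaired eq rewrite eq = e-in , ẽ-out , straightIn-path
  ... | paired p rewrite pairedIn p = proj₁ (pair-arcs p) , proj₂ (pair-arcs p) , gadgetIn-path
  route-valid {outD} {e} e-out with outView e
  ... | unpaired eq rewrite eq = ẽ-out , e-out , straightOut-path
  ... | paired p rewrite pairedOut p =
    proj₁ (pair-arcs p) , proj₂ (pair-arcs p) , outLabels-path (e ∈A? Tout)

  route-in-S : ∀ {s e} → Rel v s e → All (InS v) (vertices (routeOf s e))
  route-in-S r = valid-in-S _ (route-valid r)

  -- The path through each vertex of S_v, read off from its arc, label and the pairing.
  ownerIn ownerOut : Arc ℰ → Fin 31 → Maybe (Arc ℰ × Arc ℰ) → Dir × Arc ℰ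
  ownerIn  z k (just (x , y)) = sideOf (X k) x y
  ownerIn  z k nothing        = inD , z
  ownerOut z k (just (x , y)) = sideOf (Y k) x y
  ownerOut z k nothing        = outD , z

  owner : Vtx ℰ → Dir × Arc ℰ
  owner (a z k) with tgt z FP.≟ v
  ... | yes _ = ownerIn  z k (partnerIn z)
  ... | no  _ = ownerOut z k (partnerOut z)
  owner (b _ _) = outD , ẽ

  -- On the gadget of a pair the owner is given by the label (b^v belongs to the path of ẽ).
  owner-pair : ∀ {x y} → (x , y) ∈ pairs → ∀ {l} → (∀ {k} → l ≡ Bv k → y ≡ ẽ)
             → owner (interp x y l) ≡ sideOf l x y
  owner-pair {x} p {X k} _ with tgt x FP.≟ v
  ... | yes _ rewrite pairedIn p = refl
  ... | no x-not-in = ⊥-elim (x-not-in (proj₁ (pair-arcs p)))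
  owner-pair {y = y} p {Y k} _ with tgt y FP.≟ v
  ... | yes y-in = ⊥-elim (in-and-out {e = y} y-in (proj₂ (pair-arcs p)))
  ... | no  _ rewrite pairedOut p = refl
  owner-pair {x} {y} p {Bv k} hub =
    trans (cong (outD ,_) (sym (hub refl))) (sym (sideOf-out {x = x} {y} (proj₁ (hub-only-on-17 k))))

  owner-unpairedIn : ∀ {e} → InArc v e → partnerIn e ≡ nothing → ∀ k → owner (a e k) ≡ (inD , e)
  owner-unpairedIn {e} e-in eq k with tgt e FP.≟ v
  ... | yes _ rewrite eq = refl
  ... | no e-not-in = ⊥-elim (e-not-in e-in)

  owner-unpairedOut : ∀ {e} → OutArc v e → partnerOut e ≡ nothing → ∀ k → owner (a e k) ≡ (outD , e)
  owner-unpairedOut {e} e-out eq k with tgt e FP.≟ v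
  ... | yes e-in = ⊥-elim (in-and-out {e = e} e-in e-out)
  ... | no _ rewrite eq = refl

  owned : ∀ {s e u} → Rel v s e → u ∈ vertices (routeOf s e) → owner u ≡ (s , e)
  owned {inD} {e} e-in u∈ with inView e
  ... | unpaired eq rewrite eq with ∈-map⁻ (interp e ẽ) {xs = straightIn} u∈
  ...   | l , l∈ , refl with ∈-map⁻ X l∈
  ...     | k , _ , refl = owner-unpairedIn e-in eq k
  owned {inD} {e} e-in u∈ | paired {y} p rewrite pairedIn p with ∈-map⁻ (interp e y) {xs = gadgetIn} u∈
  ...   | l , l∈ , refl =
    trans (owner-pair p λ { refl → ⊥-elim (proj₁ (hub-only-on-17 _) l∈) }) (sideOf-in l∈)
  owned {outD} {e} e-out u∈ with outView e
  ... | unpaired eq rewrite eq with ∈-map⁻ (interp (opposite ẽ) e) {xs = straightOut} u∈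
  ...   | l , l∈ , refl with ∈-map⁻ Y l∈
  ...     | k , _ , refl = owner-unpairedOut e-out eq k
  owned {outD} {e} e-out u∈ | paired {x} p rewrite pairedOut p with e ∈A? Tout
  ... | yes _ with ∈-map⁻ (interp x e) {xs = gadgetOut15} u∈
  ...   | l , l∈ , refl = trans (owner-pair p λ { refl → ⊥-elim (proj₁ (proj₂ (hub-only-on-17 _)) l∈) })
                                (sideOf-out (All.lookup gadgetOut15-avoids-in l∈))
  owned {outD} {e} e-out u∈ | paired {x} p | no e∉ with ∈-map⁻ (interp x e) {xs = gadgetOut17} u∈
  ...   | l , l∈ , refl = trans (owner-pair p λ _ → spare p e∉)
                                (sideOf-out (All.lookup gadgetOut17-avoids-in l∈))

  OnSomePath : Vtx ℰ → Set
  OnSomePath u = Σ Dir λ s → Σ (Arc ℰ) λ e → Rel v s e × u ∈ vertices (routeOf s e)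

  pair-on-path : ∀ {x y} → (x , y) ∈ pairs
               → ∀ {l} → l ∈ gadgetIn ⊎ (l ∈ gadgetOut15 × l ∈ gadgetOut17) → OnSomePath (interp x y l)
  pair-on-path {x} {y} p (inj₁ l∈) =
    inD , x , proj₁ (pair-arcs p) ,
    subst (λ t → _ ∈ vertices (inRouteFor x t)) (sym (pairedIn p)) (∈-map⁺ (interp x y) l∈)
  pair-on-path {x} {y} p {l} (inj₂ (l∈15 , l∈17)) =
    outD , y , proj₂ (pair-arcs p) ,
    subst (λ t → _ ∈ vertices (outRouteFor y t)) (sym (pairedOut p)) on-out
    where
    on-out : interp x y l ∈ map (interp x y) (outLabels (y ∈A? Tout))
    on-out with y ∈A? Tout
    ... | yes _ = ∈-map⁺ (interp x y) l∈15
    ... | no  _ = ∈-map⁺ (interp x y) l∈17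

  hub-on-path : ∀ k → OnSomePath (b v k)
  hub-on-path k with ∈-map⁻ proj₂ (subst (ẽ ∈_) (sym seconds) (here refl))
  ... | (x , _) , p , refl =
    outD , ẽ , ẽ-out , subst (λ t → b v k ∈ vertices (outRouteFor ẽ t)) (sym (pairedOut p)) on-out
    where
    on-out : b v k ∈ map (interp x ẽ) (outLabels (ẽ ∈A? Tout))
    on-out with ẽ ∈A? Tout
    ... | yes ẽ∈ = ⊥-elim (ẽ∉Tout ẽ∈)
    ... | no  _  = subst (λ w → b w k ∈ _) (proj₁ (pair-arcs p))
                         (∈-map⁺ (interp x ẽ) (proj₂ (proj₂ (hub-only-on-17 k))))

  covered : ∀ {u} → InS v u → OnSomePath u
  covered {a z k} (inj₁ (z-in , k≥18)) with inView z
  ... | unpaired eq = inD , z , z-in ,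
        subst (λ t → a z k ∈ vertices (inRouteFor z t)) (sym eq)
              (∈-map⁺ (interp z ẽ) (straightIn-covers k (X∈S k≥18)))
  ... | paired p = pair-on-path p (pair-covers-X k (X∈S k≥18))
  covered {a z k} (inj₂ (z-out , k≤17)) with outView z
  ... | unpaired eq = outD , z , z-out ,
        subst (λ t → a z k ∈ vertices (outRouteFor z t)) (sym eq)
              (∈-map⁺ (interp (opposite ẽ) z) (straightOut-covers k (Y∈S k≤17)))
  ... | paired p = pair-on-path p (pair-covers-Y k (Y∈S k≤17))
  covered {b _ k} refl = hub-on-path k

  in-path-paired : ∀ e → InArc v e → e ∈ Tin → IsPath G (ι (a e (# 19))) (ι (a e (# 30))) (P inD e)
  in-path-paired e _ e∈ with inView e
  ... | unpaired eq = ⊥-elim (unpairedIn eq e∈)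
  ... | paired p rewrite pairedIn p = route-path (proj₁ (pair-arcs p)) (proj₂ (pair-arcs p)) gadgetIn-path

  in-path-straight : ∀ e → InArc v e → e ∉ Tin → IsPath G (ι (a e (# 17))) (ι (a e (# 30))) (P inD e)
  in-path-straight e e-in e∉ with inView e
  ... | unpaired eq rewrite eq = route-path {y = ẽ} e-in ẽ-out straightIn-path
  ... | paired p = ⊥-elim (e∉ (first∈ p))

  out-path-paired : ∀ e → OutArc v e → e ∈ Tout → IsPath G (ι (a e (# 0))) (ι (a e (# 14))) (P outD e)
  out-path-paired e _ e∈ with outView e
  ... | unpaired eq = ⊥-elim (unpairedOut eq (there e∈))
  ... | paired p rewrite pairedOut p with e ∈A? Tout
  ...   | yes _  = route-path (proj₁ (pair-arcs p)) (proj₂ (pair-arcs p)) gadgetOut15-path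
  ...   | no  e∉ = ⊥-elim (e∉ e∈)

  out-path-other : ∀ e → OutArc v e → e ∉ Tout → IsPath G (ι (a e (# 0))) (ι (a e (# 16))) (P outD e)
  out-path-other e e-out e∉ with outView e
  ... | unpaired eq rewrite eq = route-path {opposite ẽ} {e} ẽ-out e-out straightOut-path
  ... | paired p rewrite pairedOut p with e ∈A? Tout
  ...   | yes e∈ = ⊥-elim (e∉ e∈)
  ...   | no  _  = route-path (proj₁ (pair-arcs p)) (proj₂ (pair-arcs p)) gadgetOut17-path

  -- Distinct paths are disjoint: a common vertex would have two owners.
  disjoint : ∀ s e s' e' → Rel v s e → Rel v s' e' → (s , e) ≢ (s' , e')
           → ∀ w → w ∈ P s e → w ∈ P s' e' → ⊥
  disjoint s e s' e' r r' different w w∈ w∈' with ∈-map⁻ ι w∈ | ∈-map⁻ ι w∈'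
  ... | u , u∈ , refl | u' , u∈' , ιu≡ιu'
    with inj u u' (All.lookup (route-in-S r) u∈) (All.lookup (route-in-S r') u∈') ιu≡ιu'
  ... | refl = different (trans (sym (owned r u∈)) (owned r' u∈'))

  on-path⇒in-S : ∀ w → (Σ Dir λ s → Σ (Arc ℰ) λ e → Rel v s e × w ∈ P s e)
               → Σ (Vtx ℰ) λ u → InS v u × ι u ≡ w
  on-path⇒in-S w (s , e , r , w∈) with ∈-map⁻ ι w∈
  ... | u , u∈ , refl = u , All.lookup (route-in-S r) u∈ , refl

  in-S⇒on-path : ∀ w → (Σ (Vtx ℰ) λ u → InS v u × ι u ≡ w)
               → Σ Dir λ s → Σ (Arc ℰ) λ e → Rel v s e × w ∈ P s e
  in-S⇒on-path w (u , u-in-S , refl) with covered u-in-S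
  ... | s , e , r , u∈ = s , e , r , ∈-map⁺ ι u∈

  good : Good f v G C Tin Tout P
  good = in-path-paired , in-path-straight , out-path-paired , out-path-other
       , disjoint , on-path⇒in-S , in-S⇒on-path

-- Lemma 5.2.
lemma5p2 : (d : ℕ) (ℰ : Graph) → Regular d ℰ
    → (m : ℕ) (f : Arc ℰ ↔ Fin m)
    → (v : Fin (Graph.n ℰ))
    → (G : SimpleGraph) (C : Contains f v G)
    → (Tin Tout : List (Arc ℰ))
    → Unique Tin → All (InArc v) Tin
    → Unique Tout → All (OutArc v) Tout
    → length Tin ≡ suc (length Tout)
    → Σ (Dir → Arc ℰ → List (Fin (SimpleGraph.N G))) λ P → Good f v G C Tin Tout P
lemma5p2 _ ℰ _ m f v G C Tin Tout uTin Tin-in uTout Tout-out len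
  with spare-out-arc Tin-in uTin len
... | ẽ , ẽ-out , ẽ∉Tout = P , good
  where open Construction f v G C Tin Tout ẽ Tin-in uTin ẽ-out Tout-out ẽ∉Tout uTout len
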